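{- Let $\phi$ be an LTL formula in the class on which $ofp$ is defined (see context), and let $\xi\in(2^{AP})^\omega$. If $\xi\models\phi$, then for every position $i\ge0$ the letter $\xi(i)$ satisfies the propositional formula $ofp(\phi)\!\downarrow_i$.
   Context: Let $AP$ be a finite set of atomic propositions; a literal is $a$ or $\neg a$ with $a\in AP$. Consider LTL formulas generated by $\phi::=p\mid\phi\wedge\phi\mid\phi\vee\phi\mid X\phi\mid\phi U\phi\mid\phi R\phi\mid G\phi$, where $p$ is a literal. The left arguments of $U$ and $R$ may be arbitrary LTL formulas (including $\mathit{tt},\mathit{ff}$; e.g. $F\psi=\mathit{tt}U\psi$). Semantics over $\xi=\xi(0)\xi(1)\cdots\in(2^{AP})^\omega$ with suffixes $\xi_k$: - $\xi\models a$ iff $a\in\xi(0)$, and $\xi\models\neg a$ iff $a\notin\xi(0)$; - $\xi\models X\phi$ iff $\xi_1\models\phi$; - $\xi\models\phi_1U\phi_2$ iff $\exists i\ge0$ with $\xi_i\models\phi_2$ and $\xi_j\models\phi_1$ for all $j<i$; - $\xi\models\phi_1R\phi_2$ iff either $\xi_i\models\phi_2$ for all $i$, or $\exists i$ with $\xi_i\models\phi_1\wedge\phi_2$ and $\xi_j\models\phi_2$ for all $j<i$; - $\xi\models G\phi$ iff $\xi_i\models\phi$ for all $i\ge0$. A positional literal is a triple $l=\langle p,s,d\rangle$ with $l.prop=p$ a literal, $l.start=s\in\mathbb{N}\cup\{\star\}$ and $l.duration=d\in\{\mathrm{cur},\inf,\ge\}$. The obligation formula with positions $ofp(\phi)$ is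 a positive Boolean combination (using $\wedge,\vee$) of positional literals; $[ofp(\phi)]$ denotes the set of positional literals occurring in it. It is defined recursively: - $ofp(p)=\langle p,0,\mathrm{cur}\rangle$; - $ofp(\phi_1\wedge\phi_2)=ofp(\phi_1)\wedge ofp(\phi_2)$; - $ofp(\phi_1\vee\phi_2)=ofp(\phi_1)\vee ofp(\phi_2)$ if all $l_1,l_2\in[ofp(\phi_1)]\cup[ofp(\phi_2)]$ have $l_1.start=l_2.start$ (where $\star$ equals $\star$). Otherwise $ofp(\phi_1\vee\phi_2)=ofp(\phi_1)'\vee ofp(\phi_2)'$, where $ofp(\phi_i)'$ is obtained by replacing every positional literal $\langle p,s,d\rangle$ in it by $\langle p,\star,\mathrm{cur}\rangle$; - $ofp(X\psi)=Pos(ofp(\psi),X)$; - $ofp(\phi_1U\phi_2)=Pos(ofp(\phi_2),U)$; - $ofp(\phi_1R\phi_2)=Pos(ofp(\phi_2),R)$; - $ofp(G\psi)=Pos(ofp(\psi),G)$. $Pos(t,\mathit{type})$ replaces each positional literal of $t$, keeping the Boolean structure, according to the following rules, where $i\in\mathbb{N}$: - $\langle p,i,\mathrm{cur}\rangle$ becomes $\langle p,i+1,\mathrm{cur}\rangle$ under X, $\langle p,\star,\mathrm{cur}\rangle$ under U, $\langle p,i,\mathrm{cur}\rangle$ under R, and $\langle p,i,\ge\rangle$ under G; - $\langle p,\star,\mathrm{cur}\rangle$ stays $\langle p,\star,\mathrm{cur}\rangle$ under X, U and R, and becomes $\langle p,\star,\inf\rangle$ under G; - $\langle p,i,\ge\rangle$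 becomes $\langle p,i+1,\ge\rangle$ under X, $\langle p,\star,\ge\rangle$ under U, and stays $\langle p,i,\ge\rangle$ under R and G; - $\langle p,\star,\ge\rangle$ is unchanged under X, U, R and G; - $\langle p,i,\inf\rangle$ becomes $\langle p,i+1,\inf\rangle$ under X, $\langle p,\star,\inf\rangle$ under U, and stays $\langle p,i,\inf\rangle$ under R and G; - $\langle p,\star,\inf\rangle$ is unchanged under X, U, R and G. Positional projection $ofp(\phi)\!\downarrow_i$, for $i\in\mathbb{N}$, is the propositional formula obtained from $ofp(\phi)$ by the following replacement: - each positional literal $l$ is replaced by $l.prop$ if $l.start=i$, or if $l.start\in\mathbb{N}$, $l.start<i$ and $l.duration=\ge$; - otherwise (in particular whenever $l.start=\star$) $l$ is replaced by $\mathit{tt}$; - $\wedge$ and $\vee$ are preserved. $\xi(i)$ is the $i$-th letter of $\xi$ (counting from 0), and $\xi(i)$ satisfies a propositional formula in the usual way ($a$ true iff $a\in\xi(i)$). -}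

module Defs where

open import Data.Nat using (ℕ; suc; _+_; _<_; _≟_; _<?_)
open import Data.Fin using (Fin)
open import Data.Bool using (Bool; true; false; if_then_else_) renaming (_∧_ to _&&_)
open import Data.List using (List; []; _∷_; _++_)
open import Data.Product using (Σ; _×_; _,_)
open import Data.Sum using (_⊎_)
open import Data.Unit using (⊤)
open import Data.Empty using (⊥)
open import Relation.Nullary using (¬_; yes; no; does)
open import Relation.Binary.PropositionalEquality using (_≡_)

-- Atomic propositions: AP = Fin n (a finite set). A letter is a subset of AP,
-- given by its characteristic function; a word is an infinite sequence of letters.
Letter : ℕ → Set
Letter n = Fin n → Bool

Word : ℕ → Set
Word n = ℕ → Letter n

suffix : ∀ {n} → Word n → ℕ → Word n
suffix ξ k = λ m → ξ (k + m)

data Literal (n : ℕ) : Set where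
  pos : Fin n → Literal n
  neg : Fin n → Literal n

litSat : ∀ {n} → Letter n → Literal n → Set
litSat σ (pos a) = σ a ≡ true
litSat σ (neg a) = σ a ≡ false

data LTL (n : ℕ) : Set where
  tt ff  : LTL n
  lit    : Literal n → LTL n
  ¬L     : LTL n → LTL n
  _∧L_   : LTL n → LTL n → LTL n
  _∨L_   : LTL n → LTL n → LTL n
  XL     : LTL n → LTL n
  _UL_   : LTL n → LTL n → LTL n
  _RL_   : LTL n → LTL n → LTL n
  GL     : LTL n → LTL n
  FL     : LTL n → LTL n

infix 4 _⊨_
_⊨_ : ∀ {n} → Word n → LTL n → Set
ξ ⊨ tt = ⊤
ξ ⊨ ff = ⊥
ξ ⊨ lit p = litSat (ξ 0) p
ξ ⊨ ¬L φ = ¬ (ξ ⊨ φ)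
ξ ⊨ (φ₁ ∧L φ₂) = (ξ ⊨ φ₁) × (ξ ⊨ φ₂)
ξ ⊨ (φ₁ ∨L φ₂) = (ξ ⊨ φ₁) ⊎ (ξ ⊨ φ₂)
ξ ⊨ XL φ = suffix ξ 1 ⊨ φ
ξ ⊨ (φ₁ UL φ₂) =
  Σ ℕ λ i → (suffix ξ i ⊨ φ₂) × (∀ j → j < i → suffix ξ j ⊨ φ₁)
ξ ⊨ (φ₁ RL φ₂) =
  (∀ i → suffix ξ i ⊨ φ₂)
  ⊎ (Σ ℕ λ i → (suffix ξ i ⊨ φ₁) × (suffix ξ i ⊨ φ₂)
                × (∀ j → j < i → suffix ξ j ⊨ φ₂))
ξ ⊨ GL φ = ∀ i → suffix ξ i ⊨ φ
ξ ⊨ FL φ = Σ ℕ λ i → suffix ξ i ⊨ φ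

-- The class of formulas on which ofp is defined:
-- φ ::= p | φ∧φ | φ∨φ | Xφ | ψ U φ | ψ R φ | Gφ, with ψ an arbitrary LTL formula.
data Φ (n : ℕ) : Set where
  lit : Literal n → Φ n
  _∧_ : Φ n → Φ n → Φ n
  _∨_ : Φ n → Φ n → Φ n
  X   : Φ n → Φ n
  _U_ : LTL n → Φ n → Φ n
  _R_ : LTL n → Φ n → Φ n
  G   : Φ n → Φ n

toLTL : ∀ {n} → Φ n → LTL n
toLTL (lit p) = lit p
toLTL (φ₁ ∧ φ₂) = toLTL φ₁ ∧L toLTL φ₂
toLTL (φ₁ ∨ φ₂) = toLTL φ₁ ∨L toLTL φ₂
toLTL (X φ) = XL (toLTL φ)
toLTL (ψ U φ) = ψ UL toLTL φ
toLTL (ψ R φ) = ψ RL toLTL φ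
toLTL (G φ) = GL (toLTL φ)

data Start : Set where
  at   : ℕ → Start
  star : Start

data Duration : Set where
  cur inf ge : Duration

record PosLit (n : ℕ) : Set where
  constructor ⟨_,_,_⟩
  field
    prop     : Literal n
    start    : Start
    duration : Duration
open PosLit public

data OF (n : ℕ) : Set where
  pl   : PosLit n → OF n
  _∧O_ : OF n → OF n → OF n
  _∨O_ : OF n → OF n → OF n

lits : ∀ {n} → OF n → List (PosLit n)
lits (pl l) = l ∷ []
lits (t₁ ∧O t₂) = lits t₁ ++ lits t₂
lits (t₁ ∨O t₂) = lits t₁ ++ lits t₂

startEq : Start → Start → Bool
startEq (at i) (at j) = does (i ≟ j)
startEq star star = true
startEq _ _ = false

allStartEq : ∀ {n} → List (PosLit n) → Bool
allStartEq [] = true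
allStartEq (l ∷ ls) = go ls
  where
  go : ∀ {n} → List (PosLit n) → Bool
  go [] = true
  go (k ∷ ks) = startEq (start l) (start k) && go ks

mapOF : ∀ {n} → (PosLit n → PosLit n) → OF n → OF n
mapOF f (pl l) = pl (f l)
mapOF f (t₁ ∧O t₂) = mapOF f t₁ ∧O mapOF f t₂
mapOF f (t₁ ∨O t₂) = mapOF f t₁ ∨O mapOF f t₂

starCur : ∀ {n} → PosLit n → PosLit n
starCur ⟨ p , s , d ⟩ = ⟨ p , star , cur ⟩

data PosType : Set where
  tX tU tR tG : PosType

posLit : ∀ {n} → PosType → PosLit n → PosLit n
posLit tX ⟨ p , at i , cur ⟩ = ⟨ p , at (suc i) , cur ⟩
posLit tU ⟨ p , at i , cur ⟩ = ⟨ p , star , cur ⟩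
posLit tR ⟨ p , at i , cur ⟩ = ⟨ p , at i , cur ⟩
posLit tG ⟨ p , at i , cur ⟩ = ⟨ p , at i , ge ⟩
posLit tG ⟨ p , star , cur ⟩ = ⟨ p , star , inf ⟩
posLit _  ⟨ p , star , cur ⟩ = ⟨ p , star , cur ⟩
posLit tX ⟨ p , at i , ge ⟩ = ⟨ p , at (suc i) , ge ⟩
posLit tU ⟨ p , at i , ge ⟩ = ⟨ p , star , ge ⟩
posLit tR ⟨ p , at i , ge ⟩ = ⟨ p , at i , ge ⟩
posLit tG ⟨ p , at i , ge ⟩ = ⟨ p , at i , ge ⟩
posLit _  ⟨ p , star , ge ⟩ = ⟨ p , star , ge ⟩
posLit tX ⟨ p , at i , inf ⟩ = ⟨ p , at (suc i) , inf ⟩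
posLit tU ⟨ p , at i , inf ⟩ = ⟨ p , star , inf ⟩
posLit tR ⟨ p , at i , inf ⟩ = ⟨ p , at i , inf ⟩
posLit tG ⟨ p , at i , inf ⟩ = ⟨ p , at i , inf ⟩
posLit _  ⟨ p , star , inf ⟩ = ⟨ p , star , inf ⟩

Pos : ∀ {n} → OF n → PosType → OF n
Pos t ty = mapOF (posLit ty) t

ofp : ∀ {n} → Φ n → OF n
ofp (lit p) = pl ⟨ p , at 0 , cur ⟩
ofp (φ₁ ∧ φ₂) = ofp φ₁ ∧O ofp φ₂
ofp (φ₁ ∨ φ₂) =
  if allStartEq (lits (ofp φ₁) ++ lits (ofp φ₂))
  then ofp φ₁ ∨O ofp φ₂
  else mapOF starCur (ofp φ₁) ∨O mapOF starCur (ofp φ₂)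
ofp (X ψ) = Pos (ofp ψ) tX
ofp (ψ U φ) = Pos (ofp φ) tU
ofp (ψ R φ) = Pos (ofp φ) tR
ofp (G ψ) = Pos (ofp ψ) tG

data PropF (n : ℕ) : Set where
  ptt  : PropF n
  plit : Literal n → PropF n
  _∧P_ : PropF n → PropF n → PropF n
  _∨P_ : PropF n → PropF n → PropF n

_⊨P_ : ∀ {n} → Letter n → PropF n → Set
σ ⊨P ptt = ⊤
σ ⊨P plit p = litSat σ p
σ ⊨P (f₁ ∧P f₂) = (σ ⊨P f₁) × (σ ⊨P f₂)
σ ⊨P (f₁ ∨P f₂) = (σ ⊨P f₁) ⊎ (σ ⊨P f₂)

projLit : ∀ {n} → ℕ → PosLit n → PropF n
projLit i ⟨ p , star , d ⟩ = ptt
projLit i ⟨ p , at s , d ⟩ with s ≟ i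
... | yes _ = plit p
... | no _ with s <? i | d
...   | yes _ | ge = plit p
...   | _     | _  = ptt

_↓_ : ∀ {n} → OF n → ℕ → PropF n
pl l ↓ i = projLit i l
(t₁ ∧O t₂) ↓ i = (t₁ ↓ i) ∧P (t₂ ↓ i)
(t₁ ∨O t₂) ↓ i = (t₁ ↓ i) ∨P (t₂ ↓ i)

-- A positional literal l contributes l.prop to the projection at i exactly when it is
-- active there (start i, or start below i with duration ≥); otherwise it projects to tt.  X shifts activity by one position, U makes every
-- literal inactive, and R leaves ofp unchanged while ξ ⊨ ψ R φ implies ξ ⊨ φ.  For G φ,
-- ofp φ is a conjunction of blocks whose literals share one start m; such a block only
-- becomes active at positions i ≥ m, where ξ i satisfies its projection at m because
-- ξ_{i-m} ⊨ φ.
module Submission where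

open import Defs
open import Data.Nat using (ℕ; zero; suc; _∸_; _<_; _≤_; z<s; s≤s; _≟_; _<?_; _≤?_)
open import Data.Nat.Properties using (≤-refl; <⇒≤; m∸n+n≡m; ≡ᵇ⇒≡)
open import Data.Bool using (true; false)
open import Data.Bool.Properties using (T-≡)
open import Data.List using (List; []; _∷_; _++_; map)
open import Data.List.Properties using (map-++)
open import Data.List.Relation.Unary.All as All using (All; []; _∷_)
open import Data.List.Relation.Unary.All.Properties using (map⁺; ++⁻ˡ; ++⁻ʳ)
open import Data.Product using (∃; _×_; _,_; proj₁; proj₂; uncurry)
open import Data.Sum as Sum using (_⊎_; inj₁; inj₂)
open import Data.Unit using (tt)
open import Data.Empty using (⊥; ⊥-elim)
open import Function using (_∘_; Equivalence)
open import Relation.Nullary using (yes; no)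
open import Relation.Binary.PropositionalEquality using (_≡_; refl; sym; trans; cong; cong₂; subst)

private
  variable
    n i j : ℕ
    σ : Letter n

Active : ℕ → Start → Duration → Set
Active i star   _ = ⊥
Active i (at s) d = s ≡ i ⊎ (s < i × d ≡ ge)

projLit⁺ : ∀ l → (Active i (start l) (duration l) → litSat σ (prop l)) → σ ⊨P projLit i l
projLit⁺ ⟨ p , star , d ⟩ h = tt
projLit⁺ {i = i} ⟨ p , at s , d ⟩ h with s ≟ i
... | yes s≡i = h (inj₁ s≡i)
... | no _ with s <? i | d
...   | yes s<i | ge  = h (inj₂ (s<i , refl))
...   | yes _   | cur = tt
...   | yes _   | inf = tt
...   | no _    | _   = tt

projLit⁻ : ∀ l → Active i (start l) (duration l) → σ ⊨P projLit i l → litSat σ (prop l)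
projLit⁻ {i = i} ⟨ p , at s , d ⟩ active h with s ≟ i
... | yes _ = h
... | no s≢i with s <? i | d | active
...   | yes _   | ge  | _                = h
...   | _       | _   | inj₁ s≡i         = ⊥-elim (s≢i s≡i)
...   | no s≮i  | _   | inj₂ (s<i , _)   = ⊥-elim (s≮i s<i)
...   | yes _   | cur | inj₂ (_ , ())
...   | yes _   | inf | inj₂ (_ , ())

Active-suc⁻ : ∀ {s d} → Active (suc i) (at (suc s)) d → Active i (at s) d
Active-suc⁻ (inj₁ refl)              = inj₁ refl
Active-suc⁻ (inj₂ (s≤s s<i , d≡ge)) = inj₂ (s<i , d≡ge)

Active⇒start≤ : ∀ {s d} → Active i (at s) d → s ≤ i
Active⇒start≤ (inj₁ refl)     = ≤-refl
Active⇒start≤ (inj₂ (s<i , _)) = <⇒≤ s<i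

-- The comparisons of a start suc s against position 0 compute, so these projections are tt.
projLit-X-zero : ∀ l → σ ⊨P projLit 0 (posLit tX l)
projLit-X-zero ⟨ p , star , cur ⟩ = tt
projLit-X-zero ⟨ p , star , inf ⟩ = tt
projLit-X-zero ⟨ p , star , ge ⟩  = tt
projLit-X-zero ⟨ p , at s , cur ⟩ = tt
projLit-X-zero ⟨ p , at s , inf ⟩ = tt
projLit-X-zero ⟨ p , at s , ge ⟩  = tt

projLit-X-suc : ∀ l → σ ⊨P projLit i l → σ ⊨P projLit (suc i) (posLit tX l)
projLit-X-suc ⟨ p , star , cur ⟩ _ = tt
projLit-X-suc ⟨ p , star , inf ⟩ _ = tt
projLit-X-suc ⟨ p , star , ge ⟩  _ = tt
projLit-X-suc {σ = σ} l@(⟨ p , at s , cur ⟩) h =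
  projLit⁺ _ λ a → projLit⁻ {σ = σ} l (Active-suc⁻ a) h
projLit-X-suc {σ = σ} l@(⟨ p , at s , inf ⟩) h =
  projLit⁺ _ λ a → projLit⁻ {σ = σ} l (Active-suc⁻ a) h
projLit-X-suc {σ = σ} l@(⟨ p , at s , ge ⟩)  h =
  projLit⁺ _ λ a → projLit⁻ {σ = σ} l (Active-suc⁻ a) h

projLit-U : ∀ l → σ ⊨P projLit i (posLit tU l)
projLit-U ⟨ p , star , cur ⟩ = tt
projLit-U ⟨ p , star , inf ⟩ = tt
projLit-U ⟨ p , star , ge ⟩  = tt
projLit-U ⟨ p , at s , cur ⟩ = tt
projLit-U ⟨ p , at s , inf ⟩ = tt
projLit-U ⟨ p , at s , ge ⟩  = tt

posLit-R : ∀ (l : PosLit n) → posLit tR l ≡ l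
posLit-R ⟨ p , star , cur ⟩ = refl
posLit-R ⟨ p , star , inf ⟩ = refl
posLit-R ⟨ p , star , ge ⟩  = refl
posLit-R ⟨ p , at s , cur ⟩ = refl
posLit-R ⟨ p , at s , inf ⟩ = refl
posLit-R ⟨ p , at s , ge ⟩  = refl

projLit-G-at : ∀ {m} l → start l ≡ at m →
               (m ≤ i → σ ⊨P projLit m l) → σ ⊨P projLit i (posLit tG l)
projLit-G-at {σ = σ} l@(⟨ p , at m , cur ⟩) refl h =
  projLit⁺ _ λ a → projLit⁻ {σ = σ} l (inj₁ refl) (h (Active⇒start≤ a))
projLit-G-at {σ = σ} l@(⟨ p , at m , inf ⟩) refl h =
  projLit⁺ _ λ a → projLit⁻ {σ = σ} l (inj₁ refl) (h (Active⇒start≤ a))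
projLit-G-at {σ = σ} l@(⟨ p , at m , ge ⟩)  refl h =
  projLit⁺ _ λ a → projLit⁻ {σ = σ} l (inj₁ refl) (h (Active⇒start≤ a))

projLit-G-star : ∀ l → start l ≡ star → σ ⊨P projLit i (posLit tG l)
projLit-G-star ⟨ p , star , cur ⟩ refl = tt
projLit-G-star ⟨ p , star , inf ⟩ refl = tt
projLit-G-star ⟨ p , star , ge ⟩  refl = tt

mapOF-↓-mono : ∀ {f} (t : OF n) →
               All (λ l → σ ⊨P projLit j l → σ ⊨P projLit i (f l)) (lits t) →
               σ ⊨P (t ↓ j) → σ ⊨P (mapOF f t ↓ i)
mapOF-↓-mono (pl l)     (h ∷ []) x        = h x
mapOF-↓-mono (t₁ ∧O t₂) h        (x , y)  =
  mapOF-↓-mono t₁ (++⁻ˡ (lits t₁) h) x , mapOF-↓-mono t₂ (++⁻ʳ (lits t₁) h) y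
mapOF-↓-mono (t₁ ∨O t₂) h        (inj₁ x) = inj₁ (mapOF-↓-mono t₁ (++⁻ˡ (lits t₁) h) x)
mapOF-↓-mono (t₁ ∨O t₂) h        (inj₂ y) = inj₂ (mapOF-↓-mono t₂ (++⁻ʳ (lits t₁) h) y)

mapOF-↓-trivial : ∀ {f} (t : OF n) →
                  All (λ l → σ ⊨P projLit i (f l)) (lits t) → σ ⊨P (mapOF f t ↓ i)
mapOF-↓-trivial (pl l)     (h ∷ []) = h
mapOF-↓-trivial (t₁ ∧O t₂) h        =
  mapOF-↓-trivial t₁ (++⁻ˡ (lits t₁) h) , mapOF-↓-trivial t₂ (++⁻ʳ (lits t₁) h)
mapOF-↓-trivial (t₁ ∨O t₂) h        = inj₁ (mapOF-↓-trivial t₁ (++⁻ˡ (lits t₁) h))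

mapOF-id : ∀ {f} → (∀ l → f l ≡ l) → (t : OF n) → mapOF f t ≡ t
mapOF-id f≗id (pl l)     = cong pl (f≗id l)
mapOF-id f≗id (t₁ ∧O t₂) = cong₂ _∧O_ (mapOF-id f≗id t₁) (mapOF-id f≗id t₂)
mapOF-id f≗id (t₁ ∨O t₂) = cong₂ _∨O_ (mapOF-id f≗id t₁) (mapOF-id f≗id t₂)

lits-mapOF : ∀ f (t : OF n) → lits (mapOF f t) ≡ map f (lits t)
lits-mapOF f (pl l)     = refl
lits-mapOF f (t₁ ∧O t₂) =
  trans (cong₂ _++_ (lits-mapOF f t₁) (lits-mapOF f t₂)) (sym (map-++ f (lits t₁) (lits t₂)))
lits-mapOF f (t₁ ∨O t₂) =
  trans (cong₂ _++_ (lits-mapOF f t₁) (lits-mapOF f t₂)) (sym (map-++ f (lits t₁) (lits t₂)))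

All-lits-mapOF : ∀ {P : PosLit n → Set} f t → All (P ∘ f) (lits t) → All P (lits (mapOF f t))
All-lits-mapOF {P = P} f t h = subst (All P) (sym (lits-mapOF f t)) (map⁺ h)

shiftStart : PosType → Start → Start
shiftStart tX (at s) = at (suc s)
shiftStart tX star   = star
shiftStart tU _      = star
shiftStart tR s      = s
shiftStart tG s      = s

start-posLit : ∀ ty (p : Literal n) s d → start (posLit ty ⟨ p , s , d ⟩) ≡ shiftStart ty s
start-posLit tX p (at s) = λ { cur → refl ; inf → refl ; ge → refl }
start-posLit tX p star   = λ { cur → refl ; inf → refl ; ge → refl }
start-posLit tU p (at s) = λ { cur → refl ; inf → refl ; ge → refl }
start-posLit tU p star   = λ { cur → refl ; inf → refl ; ge → refl }
start-posLit tR p (at s) = λ { cur → refl ; inf → refl ; ge → refl }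
start-posLit tR p star   = λ { cur → refl ; inf → refl ; ge → refl }
start-posLit tG p (at s) = λ { cur → refl ; inf → refl ; ge → refl }
start-posLit tG p star   = λ { cur → refl ; inf → refl ; ge → refl }

-- The invariant of ofp that makes the G case work: disjunctions never mix starts.
data Aligned {n} : OF n → Set where
  shared : ∀ {t} s → All (λ l → start l ≡ s) (lits t) → Aligned t
  _∧A_   : ∀ {t₁ t₂} → Aligned t₁ → Aligned t₂ → Aligned (t₁ ∧O t₂)

Aligned-Pos : ∀ {t : OF n} ty → Aligned t → Aligned (Pos t ty)
Aligned-Pos {t = t} ty (shared s same) =
  shared (shiftStart ty s)
         (All-lits-mapOF (posLit ty) t
           (All.map (λ { {⟨ p , s , d ⟩} refl → start-posLit ty p s d }) same))
Aligned-Pos ty (a₁ ∧A a₂) = Aligned-Pos ty a₁ ∧A Aligned-Pos ty a₂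

startEq-sound : ∀ s s′ → startEq s s′ ≡ true → s ≡ s′
startEq-sound (at i) (at j) e = cong at (≡ᵇ⇒≡ i j (Equivalence.from T-≡ e))
startEq-sound star   star   e = refl

allStartEq-sound : (ls : List (PosLit n)) → allStartEq ls ≡ true →
                   ∃ λ s → All (λ l → start l ≡ s) ls
allStartEq-sound []       _ = star , []
allStartEq-sound (l ∷ ls) e = start l , refl ∷ sameAs l ls e
  where
  sameAs : ∀ l ls → allStartEq (l ∷ ls) ≡ true → All (λ k → start k ≡ start l) ls
  sameAs l []       _ = []
  sameAs l (k ∷ ks) e with startEq (start l) (start k) | startEq-sound (start l) (start k)
  ... | true | sound = sym (sound refl) ∷ sameAs l ks e

Aligned-ofp : (φ : Φ n) → Aligned (ofp φ)
Aligned-ofp (lit p)   = shared (at 0) (refl ∷ [])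
Aligned-ofp (φ₁ ∧ φ₂) = Aligned-ofp φ₁ ∧A Aligned-ofp φ₂
Aligned-ofp (φ₁ ∨ φ₂) with allStartEq (lits (ofp φ₁) ++ lits (ofp φ₂)) in e
... | true  = uncurry shared (allStartEq-sound _ e)
... | false =
  shared star (All-lits-mapOF starCur (ofp φ₁ ∨O ofp φ₂) (All.universal (λ _ → refl) _))
Aligned-ofp (X φ)     = Aligned-Pos tX (Aligned-ofp φ)
Aligned-ofp (ψ U φ)   = Aligned-Pos tU (Aligned-ofp φ)
Aligned-ofp (ψ R φ)   = Aligned-Pos tR (Aligned-ofp φ)
Aligned-ofp (G φ)     = Aligned-Pos tG (Aligned-ofp φ)

Pos-G-↓ : ∀ {t : OF n} → Aligned t → (∀ {j} → j ≤ i → σ ⊨P (t ↓ j)) → σ ⊨P (Pos t tG ↓ i)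
Pos-G-↓ (a₁ ∧A a₂) h = Pos-G-↓ a₁ (proj₁ ∘ h) , Pos-G-↓ a₂ (proj₂ ∘ h)
Pos-G-↓ {t = t} (shared star same) _ =
  mapOF-↓-trivial t (All.map (λ {l} → projLit-G-star l) same)
Pos-G-↓ {i = i} {t = t} (shared (at m) same) h with m ≤? i
... | yes m≤i = mapOF-↓-mono t (All.map (λ {l} e x → projLit-G-at l e (λ _ → x)) same) (h m≤i)
... | no m≰i  = mapOF-↓-trivial t (All.map (λ {l} e → projLit-G-at l e (⊥-elim ∘ m≰i)) same)

ofp-∨-↓ : ∀ (φ₁ φ₂ : Φ n) → σ ⊨P (ofp φ₁ ↓ i) ⊎ σ ⊨P (ofp φ₂ ↓ i) → σ ⊨P (ofp (φ₁ ∨ φ₂) ↓ i)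
ofp-∨-↓ φ₁ φ₂ h with allStartEq (lits (ofp φ₁) ++ lits (ofp φ₂))
... | true  = h
... | false = inj₁ (mapOF-↓-trivial (ofp φ₁) (All.universal (λ _ → tt) _))

release⇒right : ∀ {ξ : Word n} {ψ φ} → ξ ⊨ ψ RL φ → ξ ⊨ φ
release⇒right (inj₁ always)                   = always 0
release⇒right (inj₂ (zero  , _ , now , _))    = now
release⇒right (inj₂ (suc _ , _ , _ , before)) = before 0 z<s

lemma4 : ∀ {n : ℕ} (φ : Φ n) (ξ : Word n) →
         ξ ⊨ toLTL φ → ∀ (i : ℕ) → ξ i ⊨P (ofp φ ↓ i)
lemma4 (lit p)   ξ h zero    = h
lemma4 (lit p)   ξ h (suc i) = tt
lemma4 (φ₁ ∧ φ₂) ξ (h₁ , h₂) i = lemma4 φ₁ ξ h₁ i , lemma4 φ₂ ξ h₂ i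
lemma4 (φ₁ ∨ φ₂) ξ h i =
  ofp-∨-↓ φ₁ φ₂ (Sum.map (λ h₁ → lemma4 φ₁ ξ h₁ i) (λ h₂ → lemma4 φ₂ ξ h₂ i) h)
lemma4 (X φ) ξ h zero    = mapOF-↓-trivial (ofp φ) (All.universal projLit-X-zero _)
lemma4 (X φ) ξ h (suc i) =
  mapOF-↓-mono (ofp φ) (All.universal projLit-X-suc _) (lemma4 φ (suffix ξ 1) h i)
lemma4 (ψ U φ) ξ h i = mapOF-↓-trivial (ofp φ) (All.universal projLit-U _)
lemma4 (ψ R φ) ξ h i =
  subst (λ t → ξ i ⊨P (t ↓ i)) (sym (mapOF-id posLit-R (ofp φ)))
        (lemma4 φ ξ (release⇒right {ψ = ψ} {φ = toLTL φ} h) i)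
lemma4 (G φ) ξ h i = Pos-G-↓ (Aligned-ofp φ) λ {j} j≤i →
  subst (λ k → ξ k ⊨P (ofp φ ↓ j)) (m∸n+n≡m j≤i) (lemma4 φ (suffix ξ (i ∸ j)) (h (i ∸ j)) j)
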